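{- $\mathrm{PAR}\notin\mathrm{IS}^0{:}B(2n+3)$; that is, there is no $h:\mathbb{N}\to\mathbb{N}$ with $h(n)\le 2n+3$ for all sufficiently large $n$ such that for every $n\in\mathbb{N}$ some instruction sequence using no auxiliary registers computes $\mathrm{PAR}_n$ with length at most $h(n)$.
   Context: Booleans are $\mathrm{F}$ and $\mathrm{T}$. An instruction sequence is a finite sequence $u_1;u_2;\dots;u_k$ of primitive instructions; its length is $k$. Basic instructions are: $\mathrm{in}{:}i.\mathrm{get}$ ($i\ge1$), $\mathrm{out}.\mathrm{set}{:}b$ ($b\in\{\mathrm{F},\mathrm{T}\}$), $\mathrm{aux}{:}i.\mathrm{get}$, $\mathrm{aux}{:}i.\mathrm{set}{:}b$, $\mathrm{aux}{:}i.\mathrm{com}$ ($i\ge1$). Each names a Boolean register ($\mathrm{in}{:}i$ input, $\mathrm{out}$ output, $\mathrm{aux}{:}i$ auxiliary) and a command: $\mathrm{get}$ leaves the register unchanged and replies its content; $\mathrm{set}{:}b$ sets the content to $b$ and replies $b$; $\mathrm{com}$ complements the content and replies the new content. Primitive instructions: for each basic instruction $a$, plain $a$, positive test ${+}a$, negative test ${ - }a$; forward jumps $\#l$ ($l\in\mathbb{N}$); termination $!$. Execution starts at $u_1$. ${+}a$ executes $a$ and proceeds with the next instruction if the reply is $\mathrm{T}$, otherwise skips the next instruction and proceeds with the one after; ${ - }a$ likewise with replies reversed; plain $a$ executes $a$ and proceeds with the next instruction; $\#l$ proceeds with the $l$th next instruction; $!$ terminates. If $l=0$ or there is no instruction to proceed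 with, inaction occurs (no termination). $X$ computes $f:\{\mathrm{F},\mathrm{T}\}^n\to\{\mathrm{F},\mathrm{T}\}$ if there is $k\in\mathbb{N}$ (at least every auxiliary index used in $X$) such that for all $b_1,\dots,b_n$: starting with $\mathrm{in}{:}i$ containing $b_i$, $\mathrm{out}$ containing $\mathrm{F}$, and $\mathrm{aux}{:}1,\dots,\mathrm{aux}{:}k$ containing $\mathrm{F}$, execution terminates with $\mathrm{out}$ containing $f(b_1,\dots,b_n)$. $\mathrm{IS}^0$ is the set of instruction sequences in which no instruction involving any register $\mathrm{aux}{:}i$ occurs. For a set $\mathcal{I}$ of instruction sequences and $f:\mathbb{N}\to\mathbb{N}$, $\mathcal{I}{:}B(f(n))$ is the class of Boolean function families $(f_n)_{n\in\mathbb{N}}$ ($f_n$ $n$-ary) for which there exists $h:\mathbb{N}\to\mathbb{N}$ with $h(n)\le f(n)$ for all sufficiently large $n$ such that for all $n$ there is $X\in\mathcal{I}$ computing $f_n$ with length at most $h(n)$. $\mathrm{PAR}=(\mathrm{PAR}_n)_{n\in\mathbb{N}}$, where $\mathrm{PAR}_n(b_1,\dots,b_n)=\mathrm{T}$ iff the number of $\mathrm{T}$'s among $b_1,\dots,b_n$ is odd. -}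

module Defs where

open import Data.Bool using (Bool; true; false; _xor_; not)
open import Data.Nat using (ℕ; zero; suc; _+_; _*_; _≤_; _<_; _≟_)
open import Data.Fin using (Fin; toℕ) renaming (zero to Fz; suc to Fs)
open import Data.Empty using (⊥)
open import Relation.Nullary using (yes; no)
open import Relation.Binary.PropositionalEquality using (_≡_)
open import Data.List using (List; []; _∷_; length; drop)
open import Data.List.Relation.Unary.All using (All)
open import Data.Maybe using (Maybe; just; nothing)
open import Data.Product using (Σ; ∃; _×_; _,_)

-- Booleans: F = false, T = true.

-- Basic instructions.  Register indices are written 0-based:
-- the constructor argument i denotes index (i + 1), i.e.
-- in-get i is in:(i+1).get, aux-get i is aux:(i+1).get, etc.
data Basic : Set where
  in-get   : ℕ → Basic
  out-set  : Bool → Basic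
  aux-get  : ℕ → Basic
  aux-set  : ℕ → Bool → Basic
  aux-com  : ℕ → Basic

data Instr : Set where
  plain : Basic → Instr
  ptest : Basic → Instr
  ntest : Basic → Instr
  jump  : ℕ → Instr
  halt  : Instr

InstrSeq : Set
InstrSeq = List Instr

-- Register state.  inp i / aux i are the contents of in:(i+1) / aux:(i+1).
record State : Set where
  constructor mkState
  field
    inp : ℕ → Bool
    out : Bool
    aux : ℕ → Bool
open State public

updAux : (ℕ → Bool) → ℕ → Bool → (ℕ → Bool)
updAux f i b j with i ≟ j
... | yes _ = b
... | no  _ = f j

doBasic : Basic → State → State × Bool
doBasic (in-get i)    s = s , inp s i
doBasic (out-set b)   s = mkState (inp s) b (aux s) , b
doBasic (aux-get i)   s = s , aux s i
doBasic (aux-set i b) s = mkState (inp s) (out s) (updAux (aux s) i b) , b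
doBasic (aux-com i)   s = mkState (inp s) (out s) (updAux (aux s) i (not (aux s i))) , not (aux s i)

-- Execution.  All control transfers go strictly forward, so fuel equal to
-- the length of the sequence suffices; `just s` means termination (by !)
-- with final state s, `nothing` means inaction.
run : ℕ → InstrSeq → State → Maybe State
run zero     _        _ = nothing
run (suc f)  []       _ = nothing
run (suc f)  (halt ∷ xs) s = just s
run (suc f)  (jump zero ∷ xs) s = nothing
run (suc f)  (jump (suc l) ∷ xs) s = run f (drop l xs) s
run (suc f)  (plain a ∷ xs) s with doBasic a s
... | s' , _ = run f xs s'
run (suc f)  (ptest a ∷ xs) s with doBasic a s
... | s' , true  = run f xs s'
... | s' , false = run f (drop 1 xs) s'
run (suc f)  (ntest a ∷ xs) s with doBasic a s
... | s' , false = run f xs s'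
... | s' , true  = run f (drop 1 xs) s'

exec : InstrSeq → State → Maybe State
exec X s = run (length X) X s

data UsesAuxAbove (k : ℕ) : Basic → Set where
  g : ∀ {i}   → k ≤ i → UsesAuxAbove k (aux-get i)
  s : ∀ {i b} → k ≤ i → UsesAuxAbove k (aux-set i b)
  c : ∀ {i}   → k ≤ i → UsesAuxAbove k (aux-com i)

data InstrAuxBounded (k : ℕ) : Instr → Set where
  pl : ∀ {a} → (UsesAuxAbove k a → ⊥) → InstrAuxBounded k (plain a)
  pt : ∀ {a} → (UsesAuxAbove k a → ⊥) → InstrAuxBounded k (ptest a)
  nt : ∀ {a} → (UsesAuxAbove k a → ⊥) → InstrAuxBounded k (ntest a)
  jp : ∀ {l} → InstrAuxBounded k (jump l)
  ht : InstrAuxBounded k halt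

-- Every auxiliary index used in X is at most k (indices 1-based: aux:(i+1) with i < k).
AuxBounded : ℕ → InstrSeq → Set
AuxBounded k X = All (InstrAuxBounded k) X

-- X computes the n-ary Boolean function f.
-- Input registers in:i with i > n and auxiliary registers aux:i with i > k
-- have arbitrary initial content.
Computes : (n : ℕ) → InstrSeq → ((Fin n → Bool) → Bool) → Set
Computes n X f =
  ∃ λ k → AuxBounded k X ×
    ((b : Fin n → Bool) (ι : ℕ → Bool) → (∀ (i : Fin n) → ι (toℕ i) ≡ b i) →
     (α : ℕ → Bool) → (∀ i → i < k → α i ≡ false) →
     ∃ λ s' → exec X (mkState ι false α) ≡ just s' × out s' ≡ f b)

data NoAuxBasic : Basic → Set where
  in-get  : ∀ {i} → NoAuxBasic (in-get i)
  out-set : ∀ {b} → NoAuxBasic (out-set b)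

data NoAuxInstr : Instr → Set where
  plain : ∀ {a} → NoAuxBasic a → NoAuxInstr (plain a)
  ptest : ∀ {a} → NoAuxBasic a → NoAuxInstr (ptest a)
  ntest : ∀ {a} → NoAuxBasic a → NoAuxInstr (ntest a)
  jump  : ∀ {l} → NoAuxInstr (jump l)
  halt  : NoAuxInstr halt

IS⁰ : InstrSeq → Set
IS⁰ X = All NoAuxInstr X

BoolFamily : Set
BoolFamily = (n : ℕ) → (Fin n → Bool) → Bool

InB : (InstrSeq → Set) → (ℕ → ℕ) → BoolFamily → Set
InB 𝓘 bound F =
  ∃ λ (h : ℕ → ℕ) →
    (∃ λ N → ∀ n → N ≤ n → h n ≤ bound n) ×
    (∀ n → ∃ λ X → 𝓘 X × Computes n X (F n) × length X ≤ h n)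

parity : (n : ℕ) → (Fin n → Bool) → Bool
parity zero    b = false
parity (suc n) b = b Fz xor parity n (λ i → b (Fs i))

PAR : BoolFamily
PAR = parity

module Submission where

-- Without auxiliary registers the output register cannot be read, so an instruction
-- sequence is a branching program on its inputs: control depends only on the position
-- and the inputs, and the result is the last value written to `out`.  We show that such
-- a program computing PAR_n has length at least 5n/2; since 5n/2 > 2n+3 for n ≥ 7, no
-- h(n) ≤ 2n+3 can bound the lengths.
--
-- The lower bound is proved for programs restricted to subcubes: fixing some inputs
-- leaves a program that must compute parity on the k remaining free inputs.  The claim
-- (`Bound`) is that a program solving two subcubes with the same k free variables,
-- started with output contents o₁ and o₂, has length L with 5k + [o₁ ≠ o₂] ≤ 2L.  It is
-- proved by induction on k and, inside, on L, analysing the head of the program: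
-- a determined instruction just moves on; a free test either starts a block of free
-- tests (fixing the last tested variable funnels all runs past the block), or is
-- followed by a determined instruction, which either jumps (one variable fewer, three
-- instructions gone), continues with the same output (the two branches merge into a
-- solver of the whole cube, two instructions shorter), or changes the output.

open import Defs
open import Data.Nat using (ℕ; _+_; _*_)
open import Relation.Nullary using (¬_)

open import Data.Bool using (Bool; true; false; not; _xor_; if_then_else_; T)
open import Data.Bool.Properties using (¬-not; not-¬; not-distribˡ-xor; not-distribʳ-xor)
  renaming (_≟_ to _≟ᵇ_)
open import Data.Nat using (zero; suc; _≤_; _<_; _≡ᵇ_; _<ᵇ_; z≤n; s≤s)
open import Data.Nat.Properties
  using (≤-refl; ≤-trans; ≤-reflexive; m∸n≤m; +-suc; +-mono-≤; +-monoʳ-≤; *-monoʳ-≤;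
         *-distribˡ-+; +-comm; +-identityʳ; suc-injective; <ᵇ⇒<; n≤1+n; m≤m+n; m≤n+m; m<m+n; <⇒≱;
         module ≤-Reasoning)
  renaming (_≟_ to _≟ℕ_)
open import Data.Nat.Induction using (<-wellFounded)
open import Data.Nat.Tactic.RingSolver using (solve-∀)
open import Data.List using (List; []; _∷_; length; drop)
open import Data.List.Properties using (length-drop)
open import Data.List.Relation.Unary.All using (_∷_)
open import Data.List.Relation.Unary.All.Properties using (drop⁺)
open import Data.Product using (∃₂; _×_; _,_)
open import Data.Unit using (⊤; tt)
open import Data.Empty using (⊥-elim)
open import Data.Maybe using (just)
open import Data.Fin using (toℕ)
open import Induction.WellFounded using (WellFounded; module All)
open import Relation.Binary.Construct.On using (wellFounded)
open import Relation.Binary.PropositionalEquality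
  using (_≡_; _≢_; refl; sym; trans; cong; subst)
open import Relation.Nullary using (yes; no; contradiction)

-- What one instruction does, given the inputs and the content of the output register,
-- in a machine without auxiliary registers: halt, continue after skipping d further
-- instructions with a new output content, or get stuck (inaction, or an auxiliary register).
data Outcome : Set where
  halts : Outcome
  moves : ℕ → Bool → Outcome
  stuck : Outcome

step : Instr → (ℕ → Bool) → Bool → Outcome
step (plain (in-get _))  ι o = moves 0 o
step (plain (out-set b)) ι o = moves 0 b
step (ptest (in-get i))  ι o = moves (if ι i then 0 else 1) o
step (ptest (out-set b)) ι o = moves (if b then 0 else 1) b
step (ntest (in-get i))  ι o = moves (if ι i then 1 else 0) o
step (ntest (out-set b)) ι o = moves (if b then 1 else 0) b
step (jump zero)         ι o = stuck
step (jump (suc l))      ι o = moves l o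
step halt                ι o = halts
step _                   ι o = stuck

data Runs (ι : ℕ → Bool) : InstrSeq → Bool → Bool → Set where
  stop : ∀ {u xs o} → step u ι o ≡ halts → Runs ι (u ∷ xs) o o
  move : ∀ {u xs o d o' r} → step u ι o ≡ moves d o' → Runs ι (drop d xs) o' r →
         Runs ι (u ∷ xs) o r

no-run : ∀ {ι o r} → ¬ Runs ι [] o r
no-run ()

runs-halt : ∀ {ι u xs o r} → step u ι o ≡ halts → Runs ι (u ∷ xs) o r → r ≡ o
runs-halt _ (stop _) = refl
runs-halt h (move m _) with trans (sym h) m
... | ()

runs-move : ∀ {ι u xs o d o' r} → step u ι o ≡ moves d o' → Runs ι (u ∷ xs) o r →
            Runs ι (drop d xs) o' r
runs-move m (stop h) with trans (sym m) h
... | ()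
runs-move m (move m' run) with trans (sym m) m'
... | refl = run

runs-stuck : ∀ {ι u xs o r} → step u ι o ≡ stuck → ¬ Runs ι (u ∷ xs) o r
runs-stuck e (stop h) with trans (sym e) h
... | ()
runs-stuck e (move m _) with trans (sym e) m
... | ()

runs-sound : ∀ fuel X {ι o α st} → IS⁰ X → run fuel X (mkState ι o α) ≡ just st →
             Runs ι X o (out st)
runs-sound zero    _        _                          ()
runs-sound (suc f) []       _                          ()
runs-sound (suc f) (_ ∷ xs) (halt ∷ _)                 refl = stop refl
runs-sound (suc f) (_ ∷ xs) (jump {zero} ∷ _)          ()
runs-sound (suc f) (_ ∷ xs) (jump {suc l} ∷ ok)        e =
  move refl (runs-sound f (drop l xs) (drop⁺ l ok) e)
runs-sound (suc f) (_ ∷ xs) (plain in-get ∷ ok)        e = move refl (runs-sound f xs ok e)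
runs-sound (suc f) (_ ∷ xs) (plain out-set ∷ ok)       e = move refl (runs-sound f xs ok e)
runs-sound (suc f) (_ ∷ xs) {ι} {o} (ptest (in-get {i}) ∷ ok) e with ι i in r
... | true  = move (cong (λ b → moves (if b then 0 else 1) o) r) (runs-sound f xs ok e)
... | false = move (cong (λ b → moves (if b then 0 else 1) o) r)
                   (runs-sound f (drop 1 xs) (drop⁺ 1 ok) e)
runs-sound (suc f) (_ ∷ xs) {ι} {o} (ntest (in-get {i}) ∷ ok) e with ι i in r
... | false = move (cong (λ b → moves (if b then 1 else 0) o) r) (runs-sound f xs ok e)
... | true  = move (cong (λ b → moves (if b then 1 else 0) o) r)
                   (runs-sound f (drop 1 xs) (drop⁺ 1 ok) e)
runs-sound (suc f) (_ ∷ xs) (ptest (out-set {true}) ∷ ok)  e = move refl (runs-sound f xs ok e)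
runs-sound (suc f) (_ ∷ xs) (ptest (out-set {false}) ∷ ok) e =
  move refl (runs-sound f (drop 1 xs) (drop⁺ 1 ok) e)
runs-sound (suc f) (_ ∷ xs) (ntest (out-set {false}) ∷ ok) e = move refl (runs-sound f xs ok e)
runs-sound (suc f) (_ ∷ xs) (ntest (out-set {true}) ∷ ok)  e =
  move refl (runs-sound f (drop 1 xs) (drop⁺ 1 ok) e)

length-drop≤ : ∀ d (xs : InstrSeq) → length (drop d xs) ≤ length xs
length-drop≤ d xs = ≤-trans (≤-reflexive (length-drop d xs)) (m∸n≤m (length xs) d)

length-drop-∷ : ∀ d (xs : InstrSeq) {v zs} → drop d xs ≡ v ∷ zs → d + suc (length zs) ≡ length xs
length-drop-∷ zero    xs       e = cong length (sym e)
length-drop-∷ (suc d) []       ()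
length-drop-∷ (suc d) (_ ∷ xs) e = cong suc (length-drop-∷ d xs e)

room-after-skip : ∀ d ys {ι o r} → Runs ι (drop (suc d) ys) o r →
                  suc (length (drop (suc d) ys)) ≤ length ys
room-after-skip d []       run = ⊥-elim (no-run run)
room-after-skip d (_ ∷ ys) _   = s≤s (length-drop≤ d ys)

-- Pointwise update of an input assignment (or of a set of free variables).
-- It commutes definitionally with shifting: (f [ suc z ≔ v ]) (suc i) = (f ∘ suc) [ z ≔ v ] i.
_[_≔_] : (ℕ → Bool) → ℕ → Bool → ℕ → Bool
(f [ z ≔ v ]) i = if i ≡ᵇ z then v else f i

update-same : ∀ f z v → (f [ z ≔ v ]) z ≡ v
update-same f zero    v = refl
update-same f (suc z) v = update-same (λ i → f (suc i)) z v

update-other : ∀ f {z i} v → i ≢ z → (f [ z ≔ v ]) i ≡ f i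
update-other f {zero}  {zero}  v i≢z = contradiction refl i≢z
update-other f {suc z} {zero}  v _   = refl
update-other f {zero}  {suc i} v _   = refl
update-other f {suc z} {suc i} v i≢z = update-other (λ j → f (suc j)) v (λ e → i≢z (cong suc e))

-- The subcube of assignments agreeing with the base β outside the free variables fr.
_∈⟨_,_⟩ : (ι β fr : ℕ → Bool) → Set
ι ∈⟨ β , fr ⟩ = ∀ i → fr i ≡ false → ι i ≡ β i

centre : ∀ {β fr} → β ∈⟨ β , fr ⟩
centre _ _ = refl

reset-∈ : ∀ {ι β fr z} v → ι ∈⟨ β , fr ⟩ → fr z ≡ true → (ι [ z ≔ v ]) ∈⟨ β , fr ⟩
reset-∈ {ι} {fr = fr} {z} v ι∈ fz i fi with i ≟ℕ z
... | yes refl = contradiction (trans (sym fz) fi) (λ ())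
... | no i≢z   = trans (update-other ι v i≢z) (ι∈ i fi)

narrow : ∀ {ι β fr z} → ι ∈⟨ β , fr [ z ≔ false ] ⟩ → ι ∈⟨ β , fr ⟩
narrow {fr = fr} {z} ι∈ i fi with i ≟ℕ z
... | yes refl = ι∈ i (update-same fr i false)
... | no i≢z   = ι∈ i (trans (update-other fr false i≢z) fi)

fixed-value : ∀ {ι β fr z w} → ι ∈⟨ β [ z ≔ w ] , fr [ z ≔ false ] ⟩ → ι z ≡ w
fixed-value {β = β} {fr} {z} {w} ι∈ = trans (ι∈ z (update-same fr z false)) (update-same β z w)

fixed-⊆ : ∀ {ι β fr z w} → fr z ≡ true → ι ∈⟨ β [ z ≔ w ] , fr [ z ≔ false ] ⟩ → ι ∈⟨ β , fr ⟩
fixed-⊆ {ι} {β} {fr} {z} {w} fz ι∈ i fi with i ≟ℕ z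
... | yes refl = contradiction (trans (sym fz) fi) (λ ())
... | no i≢z   = trans (narrow ι∈ i fi) (update-other β w i≢z)

∈-fixed : ∀ {ι β fr z w} → ι ∈⟨ β , fr ⟩ → ι z ≡ w → ι ∈⟨ β [ z ≔ w ] , fr [ z ≔ false ] ⟩
∈-fixed {ι} {β} {fr} {z} {w} ι∈ ιz i fi with i ≟ℕ z
... | yes refl = trans ιz (sym (update-same β i w))
... | no i≢z   = trans (ι∈ i (trans (sym (update-other fr false i≢z)) fi))
                       (sym (update-other β w i≢z))

#free : ℕ → (ℕ → Bool) → ℕ
#free zero    fr = 0
#free (suc n) fr = (if fr 0 then 1 else 0) + #free n (λ i → fr (suc i))

#free-fix : ∀ n fr {z} → z < n → fr z ≡ true → #free n fr ≡ suc (#free n (fr [ z ≔ false ]))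
#free-fix (suc n) fr {zero}  _         fz rewrite fz = refl
#free-fix (suc n) fr {suc z} (s≤s z<n) fz =
  trans (cong ((if fr 0 then 1 else 0) +_) (#free-fix n (λ i → fr (suc i)) z<n fz))
        (+-suc (if fr 0 then 1 else 0) _)

#free-witness : ∀ n fr {k} → #free n fr ≡ suc k → ∃₂ λ z (_ : z < n) → fr z ≡ true
#free-witness zero    fr ()
#free-witness (suc n) fr size with fr 0 in f0
... | true  = 0 , s≤s z≤n , f0
... | false with #free-witness n (λ i → fr (suc i)) size
...   | z , z<n , fz = suc z , s≤s z<n , fz

#free-all : ∀ n → #free n (λ i → i <ᵇ n) ≡ n
#free-all zero    = refl
#free-all (suc n) = cong suc (#free-all n)

parity-flip : ∀ n ι {z} → z < n →
  parity n (λ i → (ι [ z ≔ not (ι z) ]) (toℕ i)) ≡ not (parity n (λ i → ι (toℕ i)))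
parity-flip (suc n) ι {zero}  _         = sym (not-distribˡ-xor (ι 0) _)
parity-flip (suc n) ι {suc z} (s≤s z<n) =
  trans (cong (ι 0 xor_) (parity-flip n (λ i → ι (suc i)) z<n))
        (sym (not-distribʳ-xor (ι 0) _))

Det : (ℕ → Bool) → Instr → Set
Det fr u = ∀ {β ι o} → ι ∈⟨ β , fr ⟩ → step u ι o ≡ step u β o

det-narrow : ∀ {fr z u} → Det fr u → Det (fr [ z ≔ false ]) u
det-narrow det ι∈ = det (narrow ι∈)

record FreeTest (fr : ℕ → Bool) (u : Instr) : Set where
  field
    var     : ℕ
    val     : Bool
    free    : fr var ≡ true
    proceed : ∀ {ι o} → ι var ≡ val → step u ι o ≡ moves 0 o
    skips   : ∀ {ι o} → ι var ≡ not val → step u ι o ≡ moves 1 o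

data Classified (fr : ℕ → Bool) (u : Instr) : Set where
  testsFree  : FreeTest fr u → Classified fr u
  determined : Det fr u → Classified fr u

-- Every instruction is a free test or determined: only tests of input registers read
-- the inputs, and a test of a fixed register is determined.
classify : ∀ fr u → Classified fr u
classify fr (ptest (in-get z)) with fr z in fz
... | true  = testsFree (record { var = z ; val = true ; free = fz
                                ; proceed = λ e → cong (λ b → moves (if b then 0 else 1) _) e
                                ; skips   = λ e → cong (λ b → moves (if b then 0 else 1) _) e })
... | false = determined (λ ι∈ → cong (λ b → moves (if b then 0 else 1) _) (ι∈ z fz))
classify fr (ntest (in-get z)) with fr z in fz
... | true  = testsFree (record { var = z ; val = false ; free = fz
                                ; proceed = λ e → cong (λ b → moves (if b then 1 else 0) _) e
                                ; skips   = λ e → cong (λ b → moves (if b then 1 else 0) _) e })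
... | false = determined (λ ι∈ → cong (λ b → moves (if b then 1 else 0) _) (ι∈ z fz))
classify fr (plain (in-get _))    = determined (λ _ → refl)
classify fr (plain (out-set _))   = determined (λ _ → refl)
classify fr (plain (aux-get _))   = determined (λ _ → refl)
classify fr (plain (aux-set _ _)) = determined (λ _ → refl)
classify fr (plain (aux-com _))   = determined (λ _ → refl)
classify fr (ptest (out-set _))   = determined (λ _ → refl)
classify fr (ptest (aux-get _))   = determined (λ _ → refl)
classify fr (ptest (aux-set _ _)) = determined (λ _ → refl)
classify fr (ptest (aux-com _))   = determined (λ _ → refl)
classify fr (ntest (out-set _))   = determined (λ _ → refl)
classify fr (ntest (aux-get _))   = determined (λ _ → refl)
classify fr (ntest (aux-set _ _)) = determined (λ _ → refl)
classify fr (ntest (aux-com _))   = determined (λ _ → refl)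
classify fr (jump zero)           = determined (λ _ → refl)
classify fr (jump (suc _))        = determined (λ _ → refl)
classify fr halt                  = determined (λ _ → refl)

writes-output : ∀ u {ι o d o'} → step u ι o ≡ moves d o' → o' ≢ o →
                ∀ {ι' o''} → step u ι' o'' ≡ moves d o'
writes-output (plain (in-get _))  refl o≢o = contradiction refl o≢o
writes-output (plain (out-set _)) refl _   = refl
writes-output (ptest (in-get _))  refl o≢o = contradiction refl o≢o
writes-output (ptest (out-set _)) refl _   = refl
writes-output (ntest (in-get _))  refl o≢o = contradiction refl o≢o
writes-output (ntest (out-set _)) refl _   = refl
writes-output (jump (suc _))      refl o≢o = contradiction refl o≢o
writes-output (plain (aux-get _))   ()
writes-output (plain (aux-set _ _)) ()
writes-output (plain (aux-com _))   ()
writes-output (ptest (aux-get _))   ()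
writes-output (ptest (aux-set _ _)) ()
writes-output (ptest (aux-com _))   ()
writes-output (ntest (aux-get _))   ()
writes-output (ntest (aux-set _ _)) ()
writes-output (ntest (aux-com _))   ()
writes-output (jump zero)           ()
writes-output halt                  ()

HeadDet : (ℕ → Bool) → InstrSeq → Set
HeadDet fr []      = ⊤
HeadDet fr (v ∷ _) = Det fr v

head-det-narrow : ∀ {fr z} Y → HeadDet fr Y → HeadDet (fr [ z ≔ false ]) Y
head-det-narrow []      _   = tt
head-det-narrow (_ ∷ _) det = det-narrow det

-- A block of consecutive free tests at the head of xs, of length `exit`.  Once the
-- variable of its last test is fixed to the value on which that test proceeds, every
-- run entering the block leaves it at position `exit`, unchanged, where the block ends.
record BlockExit (fr : ℕ → Bool) (xs : InstrSeq) : Set where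
  field
    var      : ℕ
    val      : Bool
    free     : fr var ≡ true
    exit     : ℕ
    exit-pos : 1 ≤ exit
    after    : HeadDet fr (drop exit xs)
    funnel   : ∀ {i ι o r} → i ≤ exit → ι var ≡ val → Runs ι (drop i xs) o r →
               Runs ι (drop exit xs) o r

single-block : ∀ {fr u ys} → FreeTest fr u → HeadDet fr ys → BlockExit fr (u ∷ ys)
single-block {fr} {u} {ys} t headDet = record
  { var = FreeTest.var t ; val = FreeTest.val t ; free = FreeTest.free t
  ; exit = 1 ; exit-pos = s≤s z≤n ; after = headDet ; funnel = funnel }
  where
  funnel : ∀ {i ι o r} → i ≤ 1 → ι (FreeTest.var t) ≡ FreeTest.val t →
           Runs ι (drop i (u ∷ ys)) o r → Runs ι (drop 1 (u ∷ ys)) o r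
  funnel z≤n       e run = runs-move (FreeTest.proceed t e) run
  funnel (s≤s z≤n) _ run = run

-- Prepending a free test to a block: from its head a run reaches position 0 or 1.
extend-block : ∀ {fr u xs} → FreeTest fr u → BlockExit fr xs → BlockExit fr (u ∷ xs)
extend-block {fr} {u} {xs} t b = record
  { var = var ; val = val ; free = free
  ; exit = suc exit ; exit-pos = s≤s z≤n ; after = after ; funnel = funnel' }
  where
  open BlockExit b
  funnel' : ∀ {i ι o r} → i ≤ suc exit → ι var ≡ val →
            Runs ι (drop i (u ∷ xs)) o r → Runs ι (drop exit xs) o r
  funnel' {zero} {ι} _ e run with ι (FreeTest.var t) ≟ᵇ FreeTest.val t
  ... | yes p = funnel z≤n e (runs-move (FreeTest.proceed t p) run)
  ... | no ¬p = funnel exit-pos e (runs-move (FreeTest.skips t (¬-not ¬p)) run)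
  funnel' {suc i} (s≤s i≤exit) e run = funnel i≤exit e run

block-exit : ∀ {fr u} ys → FreeTest fr u → BlockExit fr (u ∷ ys)
block-exit         []        t = single-block t tt
block-exit {fr} (u' ∷ ys) t with classify fr u'
... | testsFree t' = extend-block t (block-exit ys t')
... | determined d = single-block t d

differ : Bool → Bool → ℕ
differ true  true  = 0
differ false false = 0
differ _     _     = 1

differ-≡ : ∀ {a b} → a ≡ b → differ a b ≡ 0
differ-≡ {true}  refl = refl
differ-≡ {false} refl = refl

differ-≢ : ∀ {a b} → a ≢ b → differ a b ≡ 1
differ-≢ {true}  {true}  a≢b = contradiction refl a≢b
differ-≢ {true}  {false} _   = refl
differ-≢ {false} {true}  _   = refl
differ-≢ {false} {false} a≢b = contradiction refl a≢b

differ-≤1 : ∀ a b → differ a b ≤ 1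
differ-≤1 true  true  = z≤n
differ-≤1 true  false = ≤-refl
differ-≤1 false true  = ≤-refl
differ-≤1 false false = z≤n

grow : ∀ a {x R L} → x ≤ 2 * R → a + R ≤ L → 2 * a + x ≤ 2 * L
grow a {x} {R} {L} x≤2R a+R≤L = begin
  2 * a + x      ≤⟨ +-monoʳ-≤ (2 * a) x≤2R ⟩
  2 * a + 2 * R  ≡⟨ sym (*-distribˡ-+ 2 a R) ⟩
  2 * (a + R)    ≤⟨ *-monoʳ-≤ 2 a+R≤L ⟩
  2 * L          ∎
  where open ≤-Reasoning

slack : ∀ e x a b → x + differ a b ≤ 2 * suc e + x
slack e x a b = ≤-trans (+-monoʳ-≤ x (differ-≤1 a b))
                        (≤-trans (≤-reflexive (+-comm x 1)) (s≤s (m≤n+m x _)))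

shorter-wf : WellFounded (λ (X Y : InstrSeq) → length X < length Y)
shorter-wf = wellFounded length <-wellFounded

module LowerBound (n : ℕ) where

  P : (ℕ → Bool) → Bool
  P ι = parity n (λ i → ι (toℕ i))

  Solves : InstrSeq → Bool → (ℕ → Bool) → (ℕ → Bool) → Set
  Solves X o β fr = ∀ ι → ι ∈⟨ β , fr ⟩ → Runs ι X o (P ι)

  Bounded : (ℕ → Bool) → Set
  Bounded fr = ∀ i → fr i ≡ true → i < n

  bounded-fix : ∀ {fr} z → Bounded fr → Bounded (fr [ z ≔ false ])
  bounded-fix {fr} z bd i fi with i ≟ℕ z
  ... | yes refl = contradiction (trans (sym (update-same fr i false)) fi) (λ ())
  ... | no i≢z   = bd i (trans (sym (update-other fr false i≢z)) fi)

  size-fix : ∀ {fr k z} → Bounded fr → fr z ≡ true → #free n fr ≡ suc k →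
             #free n (fr [ z ≔ false ]) ≡ k
  size-fix {fr} {z = z} bd fz size = suc-injective (trans (sym (#free-fix n fr (bd z fz) fz)) size)

  parity-varies : ∀ {fr β k o} → #free n fr ≡ suc k → ¬ (∀ ι → ι ∈⟨ β , fr ⟩ → P ι ≡ o)
  parity-varies {fr} {β} size const with #free-witness n fr size
  ... | z , z<n , fz = not-¬ refl P-self-inverse
    where
    flipped : (β [ z ≔ not (β z) ]) ∈⟨ β , fr ⟩
    flipped = reset-∈ (not (β z)) (centre {β} {fr}) fz
    P-self-inverse : P β ≡ not (P β)
    P-self-inverse = trans (const β centre)
                           (trans (sym (const _ flipped)) (parity-flip n β z<n))

  -- A determined instruction heading a solver of a subcube with a free variable neither
  -- halts (parity varies) nor gets stuck: it moves on, to a solver of the same subcube.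
  det-step : ∀ {fr β u xs o k} → Det fr u → #free n fr ≡ suc k → Solves (u ∷ xs) o β fr →
             ∃₂ λ d o' → step u β o ≡ moves d o' × Solves (drop d xs) o' β fr
  det-step {β = β} {u} {o = o} det size sol with step u β o in eq
  ... | halts = ⊥-elim (parity-varies size λ ι ι∈ → runs-halt (trans (det ι∈) eq) (sol ι ι∈))
  ... | stuck = ⊥-elim (runs-stuck eq (sol β centre))
  ... | moves d o' = d , o' , refl , λ ι ι∈ → runs-move (trans (det ι∈) eq) (sol ι ι∈)

  module _ {fr u xs o β} (t : FreeTest fr u) (sol : Solves (u ∷ xs) o β fr) where
    open FreeTest t

    take-branch : Solves xs o (β [ var ≔ val ]) (fr [ var ≔ false ])
    take-branch ι ι∈ = runs-move (proceed (fixed-value ι∈)) (sol ι (fixed-⊆ free ι∈))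

    skip-branch : Solves (drop 1 xs) o (β [ var ≔ not val ]) (fr [ var ≔ false ])
    skip-branch ι ι∈ = runs-move (skips (fixed-value ι∈)) (sol ι (fixed-⊆ free ι∈))

  merge : ∀ {Y o β fr z w} → Solves Y o (β [ z ≔ w ]) (fr [ z ≔ false ]) →
          Solves Y o (β [ z ≔ not w ]) (fr [ z ≔ false ]) → Solves Y o β fr
  merge {z = z} {w} on-w on-not-w ι ι∈ with ι z ≟ᵇ w
  ... | yes e  = on-w ι (∈-fixed ι∈ e)
  ... | no  ¬e = on-not-w ι (∈-fixed ι∈ (¬-not ¬e))

  -- The skipping branch of a free test must land on an instruction.
  free-test-length : ∀ {fr u xs o β} → FreeTest fr u → Solves (u ∷ xs) o β fr → 3 ≤ length (u ∷ xs)
  free-test-length {xs = []}        t sol = ⊥-elim (no-run (skip-branch t sol _ centre))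
  free-test-length {xs = _ ∷ []}    t sol = ⊥-elim (no-run (skip-branch t sol _ centre))
  free-test-length {xs = _ ∷ _ ∷ _} _ _   = s≤s (s≤s (s≤s z≤n))

  Bound : ℕ → InstrSeq → Set
  Bound k X = ∀ {fr β₁ β₂ o₁ o₂} → Bounded fr → #free n fr ≡ k →
              Solves X o₁ β₁ fr → Solves X o₂ β₂ fr → 5 * k + differ o₁ o₂ ≤ 2 * length X

  bound-single : ∀ {k X fr β o} → Bound k X → Bounded fr → #free n fr ≡ k → Solves X o β fr →
                 5 * k ≤ 2 * length X
  bound-single {k} {o = o} B bd size sol =
    ≤-trans (≤-reflexive (sym (trans (cong (5 * k +_) (differ-≡ {o} refl)) (+-identityʳ (5 * k)))))
            (B bd size sol sol)

  record Subproblem (k L : ℕ) : Set where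
    field
      program : InstrSeq
      fr      : ℕ → Bool
      base    : ℕ → Bool
      start   : Bool
      room    : 3 + length program ≤ L
      bounded : Bounded fr
      size    : #free n fr ≡ k
      solves  : Solves program start base fr

  subproblem-bound : ∀ {k L} → (∀ Y → Bound k Y) → Subproblem k L → 5 * suc k + 1 ≤ 2 * L
  subproblem-bound {k} ih p =
    ≤-trans (≤-reflexive (six-more k)) (grow 3 (bound-single (ih program) bounded size solves) room)
    where
    open Subproblem p
    six-more : ∀ k → 5 * suc k + 1 ≡ 2 * 3 + 5 * k
    six-more = solve-∀

  past-block : ∀ {k fr β o} j X → 2 ≤ j → HeadDet fr (drop j X) → Bounded fr →
               #free n fr ≡ suc k → Solves (drop j X) o β fr → Subproblem (suc k) (length X)
  past-block j X 2≤j head bd size sol with drop j X in eq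
  ... | []     = ⊥-elim (no-run (sol _ centre))
  ... | v ∷ zs with det-step head size sol
  ...   | d , _ , _ , sol' = record
    { program = drop d zs ; room = room ; bounded = bd ; size = size ; solves = sol' }
    where
    room : 3 + length (drop d zs) ≤ length X
    room = ≤-trans (+-mono-≤ 2≤j (s≤s (length-drop≤ d zs))) (≤-reflexive (length-drop-∷ j X eq))

  free-block : ∀ {k fr β u u' ys o} → FreeTest fr u → FreeTest fr u' → Bounded fr →
               #free n fr ≡ suc (suc k) → Solves (u ∷ u' ∷ ys) o β fr →
               Subproblem (suc k) (length (u ∷ u' ∷ ys))
  free-block {fr = fr} {u = u} {u'} {ys} t t' bd size sol =
    past-block exit (u ∷ u' ∷ ys) (s≤s (BlockExit.exit-pos inner)) (head-det-narrow _ after)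
               (bounded-fix var bd) (size-fix bd free size)
               (λ ι ι∈ → funnel z≤n (fixed-value ι∈) (sol ι (fixed-⊆ free ι∈)))
    where
    inner : BlockExit fr (u' ∷ ys)
    inner = block-exit ys t'
    open BlockExit (extend-block t inner)

  via-subproblem : ∀ {k L} o₁ o₂ → (∀ Y → Bound k Y) → Subproblem k L →
                   5 * suc k + differ o₁ o₂ ≤ 2 * L
  via-subproblem {k} o₁ o₂ ih p =
    ≤-trans (+-monoʳ-≤ (5 * suc k) (differ-≤1 o₁ o₂)) (subproblem-bound ih p)

  det-first : ∀ {k u xs fr β₁ o₁} o₂ → (∀ {Y} → length Y < length (u ∷ xs) → Bound (suc k) Y) →
              Det fr u → Bounded fr → #free n fr ≡ suc k → Solves (u ∷ xs) o₁ β₁ fr →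
              5 * suc k + differ o₁ o₂ ≤ 2 * length (u ∷ xs)
  det-first {k} {xs = xs} {o₁ = o₁} o₂ rec det bd size sol with det-step det size sol
  ... | d , _ , _ , sol' =
    ≤-trans (slack 0 (5 * suc k) o₁ o₂) (grow 1 (bound-single (rec shorter) bd size sol') shorter)
    where
    shorter : suc (length (drop d xs)) ≤ suc (length xs)
    shorter = s≤s (length-drop≤ d xs)

  -- Fix the tested variable z to
  -- the value on which the test proceeds to u'; then u'
  --   * jumps: a subproblem with one variable fewer remains;
  --   * moves to the next instruction keeping the output: both halves of the subcube
  --     continue at ys with the same output, so ys solves the whole subcube;
  --   * moves to the next instruction changing the output: u' writes the output, so
  --     either the second subcube merges at ys, or (when o₁ = o₂) ys solves the two
  --     halves of the first subcube from different outputs, one variable fewer.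
  module FreeThenDet {m u u' ys fr β₁ β₂ o₁ o₂}
    (ih   : ∀ Y → Bound (suc m) Y)
    (rec  : ∀ {Y} → length Y < length (u ∷ u' ∷ ys) → Bound (suc (suc m)) Y)
    (t    : FreeTest fr u) (det : Det fr u') (bd : Bounded fr) (size : #free n fr ≡ suc (suc m))
    (sol₁ : Solves (u ∷ u' ∷ ys) o₁ β₁ fr) (sol₂ : Solves (u ∷ u' ∷ ys) o₂ β₂ fr) where

    open FreeTest t

    L : ℕ
    L = length (u ∷ u' ∷ ys)

    size' : #free n (fr [ var ≔ false ]) ≡ suc m
    size' = size-fix bd free size

    jumped : ∀ d {o'} → Solves (drop (suc d) ys) o' (β₁ [ var ≔ val ]) (fr [ var ≔ false ]) →
             5 * suc (suc m) + differ o₁ o₂ ≤ 2 * L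
    jumped d sol = via-subproblem o₁ o₂ ih (record
      { program = drop (suc d) ys ; room = s≤s (s≤s (room-after-skip d ys (sol _ centre)))
      ; bounded = bounded-fix var bd ; size = size' ; solves = sol })

    merged : ∀ {o β} → Solves ys o β fr → 5 * suc (suc m) + differ o₁ o₂ ≤ 2 * L
    merged sol = ≤-trans (slack 1 (5 * suc (suc m)) o₁ o₂)
                         (grow 2 (bound-single (rec ys<L) bd size sol) ≤-refl)
      where
      ys<L : length ys < L
      ys<L = s≤s (n≤1+n (length ys))

    split : ∀ {o'} → o' ≢ o₁ → o₂ ≢ o' →
            Solves ys o' (β₁ [ var ≔ val ]) (fr [ var ≔ false ]) →
            5 * suc (suc m) + differ o₁ o₂ ≤ 2 * L
    split {o'} changed o₂≢o' sol = ≤-trans (≤-reflexive arith) (grow 2 halves ≤-refl)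
      where
      halves : 5 * suc m + differ o₁ o' ≤ 2 * length ys
      halves = ih ys (bounded-fix var bd) size' (skip-branch t sol₁) sol
      same : o₁ ≡ o₂
      same = trans (¬-not (λ e → changed (sym e))) (sym (¬-not o₂≢o'))
      arith : 5 * suc (suc m) + differ o₁ o₂ ≡ 2 * 2 + (5 * suc m + differ o₁ o')
      arith rewrite differ-≡ same | differ-≢ (λ e → changed (sym e)) = five-more m
        where
        five-more : ∀ m → 5 * suc (suc m) + 0 ≡ 2 * 2 + (5 * suc m + 1)
        five-more = solve-∀

    free-then-det : 5 * suc (suc m) + differ o₁ o₂ ≤ 2 * L
    free-then-det with det-step (det-narrow det) size' (take-branch t sol₁)
    ... | suc d , _  , _     , sol = jumped d sol
    ... | zero  , o' , moved , sol with o' ≟ᵇ o₁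
    ...   | yes refl    = merged (merge sol (skip-branch t sol₁))
    ...   | no  changed with o₂ ≟ᵇ o'
    ...     | yes refl   = merged (merge (λ ι ι∈ → runs-move (writes-output u' moved changed)
                                                              (take-branch t sol₂ ι ι∈))
                                         (skip-branch t sol₂))
    ...     | no o₂≢o'   = split changed o₂≢o' sol

  Previous : ℕ → Set
  Previous zero    = ⊤
  Previous (suc m) = ∀ Y → Bound (suc m) Y

  -- A free test at the head: three instructions suffice for one variable; otherwise the
  -- next instruction is a free test (a block) or determined (`FreeThenDet`).
  free-first : ∀ m {u xs fr β₁ β₂ o₁ o₂} → Previous m →
               (∀ {Y} → length Y < length (u ∷ xs) → Bound (suc m) Y) →
               FreeTest fr u → Bounded fr → #free n fr ≡ suc m →
               Solves (u ∷ xs) o₁ β₁ fr → Solves (u ∷ xs) o₂ β₂ fr →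
               5 * suc m + differ o₁ o₂ ≤ 2 * length (u ∷ xs)
  free-first zero {o₁ = o₁} {o₂} _ _ t _ _ sol₁ _ =
    ≤-trans (+-monoʳ-≤ 5 (differ-≤1 o₁ o₂)) (*-monoʳ-≤ 2 (free-test-length t sol₁))
  free-first (suc m) {xs = []} _ _ t _ _ sol₁ _ = ⊥-elim (no-run (take-branch t sol₁ _ centre))
  free-first (suc m) {xs = u' ∷ ys} {fr} {o₁ = o₁} {o₂} ih rec t bd size sol₁ sol₂
    with classify fr u'
  ... | testsFree t' = via-subproblem o₁ o₂ ih (free-block t t' bd size sol₁)
  ... | determined d = FreeThenDet.free-then-det ih rec t d bd size sol₁ sol₂

  bound-step : ∀ m → Previous m → ∀ X → (∀ {Y} → length Y < length X → Bound (suc m) Y) →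
               Bound (suc m) X
  bound-step m ih []       _   _ _ sol₁ _ = ⊥-elim (no-run (sol₁ _ centre))
  bound-step m ih (u ∷ xs) rec {fr} {o₂ = o₂} bd size sol₁ sol₂ with classify fr u
  ... | testsFree t  = free-first m ih rec t bd size sol₁ sol₂
  ... | determined d = det-first o₂ rec d bd size sol₁

  bound : ∀ m X → Bound (suc m) X
  bound zero    = All.wfRec shorter-wf _ (Bound 1) (bound-step zero tt)
  bound (suc m) = All.wfRec shorter-wf _ (Bound (suc (suc m))) (bound-step (suc m) (bound m))

  computes-solves : ∀ {X} → IS⁰ X → Computes n X (parity n) →
                    Solves X false (λ _ → false) (λ i → i <ᵇ n)
  computes-solves {X} ok (_ , _ , correct) ι _
    with correct (λ i → ι (toℕ i)) ι (λ _ → refl) (λ _ → false) (λ _ _ → refl)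
  ... | _ , terminates , result = subst (Runs ι X false) result (runs-sound (length X) X ok terminates)

parity-length : ∀ n X → IS⁰ X → Computes n X (parity n) → 5 * n ≤ 2 * length X
parity-length zero    X _  _        = z≤n
parity-length (suc m) X ok computes =
  bound-single (bound m X) (λ i fi → <ᵇ⇒< i (suc m) (subst T (sym fi) tt)) (#free-all (suc m))
               (computes-solves ok computes)
  where open LowerBound (suc m)

beyond : ∀ N → 2 * (2 * (N + 7) + 3) < 5 * (N + 7)
beyond N = ≤-trans (m<m+n (2 * (2 * (N + 7) + 3)) {suc N} (s≤s z≤n)) (≤-reflexive (rearrange N))
  where
  rearrange : ∀ N → 2 * (2 * (N + 7) + 3) + suc N ≡ 5 * (N + 7)
  rearrange = solve-∀

theorem3 : ¬ InB IS⁰ (λ n → 2 * n + 3) PAR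
theorem3 (_ , (N , h≤) , programs) with programs (N + 7)
... | X , ok , computes , |X|≤h = <⇒≱ (beyond N) five-halves
  where
  five-halves : 5 * (N + 7) ≤ 2 * (2 * (N + 7) + 3)
  five-halves = ≤-trans (parity-length (N + 7) X ok computes)
                        (*-monoʳ-≤ 2 (≤-trans |X|≤h (h≤ (N + 7) (m≤m+n N 7))))
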